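{- Let $m\ge1$. For each prime $p<z_m$, \[\left\lfloor\frac{\log z_m}{\log p}\right\rfloor-1\le k_p\le\left\lfloor\frac{\log z_m}{\log p}\right\rfloor.\]
   Context: Consider all pairs $(q,k)$ with $q$ prime and $k\ge 1$ an integer, with value $z_{q,k}:=q+q^2+\cdots+q^k$. Enumerate these pairs as $(q_1,k_1),(q_2,k_2),\dots$ so that $z_i:=z_{q_i,k_i}$ is nondecreasing in $i$; if $z_{q,k}=z_{p,j}$ with $q>p$, then $(q,k)$ comes before $(p,j)$. For $m\ge1$ let $E_m$ be the set of the first $m$ pairs; for each prime $p$ let $k_p$ be the largest $k$ with $(p,k)\in E_m$ ($k_p=0$ if none), and $n_m:=\prod_p p^{k_p}$. -}

module Defs where

open import Data.Nat using (ℕ; zero; suc; _+_; _*_; _^_; _≤_; _<_; _⊔_; _≟_)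
open import Data.Nat.Primality using (Prime)
open import Data.Product using (Σ; _×_; ∃)
open import Data.Sum using (_⊎_)
open import Data.Bool using (if_then_else_)
open import Relation.Nullary using (does)
open import Relation.Binary.PropositionalEquality using (_≡_)

z : ℕ → ℕ → ℕ
z q zero    = 0
z q (suc k) = z q k + q ^ suc k

Before : ℕ → ℕ → ℕ → ℕ → Set
Before q k p j = z q k < z p j ⊎ (z q k ≡ z p j × p < q)

-- Values at index 0 are irrelevant.
record Enumeration : Set where
  field
    qs    : ℕ → ℕ
    ks    : ℕ → ℕ
    prime : ∀ i → 1 ≤ i → Prime (qs i)
    kpos  : ∀ i → 1 ≤ i → 1 ≤ ks i
    mono  : ∀ i j → 1 ≤ i → i < j → Before (qs i) (ks i) (qs j) (ks j)
    onto  : ∀ p j → Prime p → 1 ≤ j → Σ ℕ (λ i → 1 ≤ i × qs i ≡ p × ks i ≡ j)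

open Enumeration public

zAt : Enumeration → ℕ → ℕ
zAt E i = z (qs E i) (ks E i)

-- k_p for E_m = {(q_1,k_1),...,(q_m,k_m)}: the largest k with (p,k) ∈ E_m, 0 if none.
kp : Enumeration → ℕ → ℕ → ℕ
kp E zero    p = 0
kp E (suc m) p =
  if does (qs E (suc m) ≟ p) then ks E (suc m) ⊔ kp E m p else kp E m p

-- e = ⌊ log x / log b ⌋  (for b ≥ 2, x ≥ 1): b^e ≤ x < b^(e+1)
IsFloorLog : ℕ → ℕ → ℕ → Set
IsFloorLog b x e = b ^ e ≤ x × x < b ^ suc e

{-# OPTIONS --safe #-}
module Submission where

-- Every pair (p, k) with z p k < z_m lies among the first m pairs, and every
-- pair among them has z p k ≤ z_m.  Since p^k ≤ z p k < p^(k+1), the first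
-- fact gives (p, e - 1) ∈ E_m when p^e ≤ z_m, and the second forces every
-- (p, k) ∈ E_m to satisfy p^k ≤ z_m < p^(e+1), i.e. k ≤ e.

open import Defs
open import Data.Nat using (ℕ; zero; suc; _+_; _*_; _^_; _⊔_; _≤_; _<_; _∸_; _≟_; z≤n; s≤s; z<s; NonZero; >-nonZero; nonTrivial⇒n>1)
open import Data.Nat.Properties
open import Data.Nat.Primality using (Prime; prime⇒nonTrivial)
open import Data.Product using (_×_; _,_)
open import Data.Sum using (inj₁; inj₂)
open import Data.Empty using (⊥-elim)
open import Relation.Nullary using (yes; no)
open import Relation.Nullary.Decidable using (dec-true; dec-false)
open import Relation.Binary.PropositionalEquality using (_≡_; _≢_; refl; sym; cong; cong₂)

^≤z : ∀ b k → 1 ≤ k → b ^ k ≤ z b k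
^≤z b (suc k) _ = m≤n+m (b ^ suc k) (z b k)

z<^suc : ∀ b → 1 < b → ∀ k → z b k < b ^ suc k
z<^suc b 1<b zero = <-trans z<s (≤-trans 1<b (≤-reflexive (sym (*-identityʳ b))))
z<^suc b 1<b (suc k) = begin-strict
  z b k + b ^ suc k      <⟨ +-monoˡ-< (b ^ suc k) (z<^suc b 1<b k) ⟩
  b ^ suc k + b ^ suc k  ≡⟨ cong (b ^ suc k +_) (sym (+-identityʳ (b ^ suc k))) ⟩
  2 * b ^ suc k          ≤⟨ *-monoˡ-≤ (b ^ suc k) 1<b ⟩
  b * b ^ suc k          ∎
  where open ≤-Reasoning

^-cancelʳ-< : ∀ b → 1 < b → ∀ {m n} → b ^ m < b ^ n → m < n
^-cancelʳ-< b 1<b {m} {n} bᵐ<bⁿ = ≰⇒> λ n≤m → <⇒≱ bᵐ<bⁿ (^-monoʳ-≤ b n≤m)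
  where instance _ : NonZero b
                 _ = >-nonZero (<-trans z<s 1<b)

module _ (E : Enumeration) where

  zAt-mono : ∀ {i j} → 1 ≤ i → i ≤ j → zAt E i ≤ zAt E j
  zAt-mono {i} {j} 1≤i i≤j with m≤n⇒m<n∨m≡n i≤j
  ... | inj₂ refl = ≤-refl
  ... | inj₁ i<j with mono E i j 1≤i i<j
  ...   | inj₁ zᵢ<zⱼ       = <⇒≤ zᵢ<zⱼ
  ...   | inj₂ (zᵢ≡zⱼ , _) = ≤-reflexive zᵢ≡zⱼ

  zAt<⇒≤ : ∀ {i m} → 1 ≤ m → zAt E i < zAt E m → i ≤ m
  zAt<⇒≤ 1≤m zᵢ<zₘ = ≮⇒≥ λ m<i → <⇒≱ zᵢ<zₘ (zAt-mono 1≤m (<⇒≤ m<i))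

  kp-suc-≡ : ∀ {p} m → qs E (suc m) ≡ p → kp E (suc m) p ≡ ks E (suc m) ⊔ kp E m p
  kp-suc-≡ {p} m qₘ≡p rewrite dec-true (qs E (suc m) ≟ p) qₘ≡p = refl

  kp-suc-≢ : ∀ {p} m → qs E (suc m) ≢ p → kp E (suc m) p ≡ kp E m p
  kp-suc-≢ {p} m qₘ≢p rewrite dec-false (qs E (suc m) ≟ p) qₘ≢p = refl

  kp-lub : ∀ {p e} m → (∀ i → 1 ≤ i → i ≤ m → qs E i ≡ p → ks E i ≤ e) → kp E m p ≤ e
  kp-lub zero    _     = z≤n
  kp-lub {p} (suc m) bound with qs E (suc m) ≟ p
  ... | yes qₘ≡p rewrite kp-suc-≡ m qₘ≡p =
        ⊔-lub (bound (suc m) (s≤s z≤n) ≤-refl qₘ≡p) (kp-lub m λ i 1≤i i≤m → bound i 1≤i (m≤n⇒m≤1+n i≤m))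
  ... | no qₘ≢p rewrite kp-suc-≢ m qₘ≢p =
        kp-lub m λ i 1≤i i≤m → bound i 1≤i (m≤n⇒m≤1+n i≤m)

  ks≤kp : ∀ {p i} m → 1 ≤ i → i ≤ m → qs E i ≡ p → ks E i ≤ kp E m p
  ks≤kp zero    1≤i i≤0 _ = ⊥-elim (<⇒≱ 1≤i i≤0)
  ks≤kp {p} (suc m) 1≤i i≤m qᵢ≡p with qs E (suc m) ≟ p | m≤n⇒m<n∨m≡n i≤m
  ... | yes qₘ≡p | inj₂ refl rewrite kp-suc-≡ m qₘ≡p = m≤m⊔n _ _
  ... | yes qₘ≡p | inj₁ i<m  rewrite kp-suc-≡ m qₘ≡p = ≤-trans (ks≤kp m 1≤i (≤-pred i<m) qᵢ≡p) (m≤n⊔m _ _)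
  ... | no qₘ≢p  | inj₂ refl = ⊥-elim (qₘ≢p qᵢ≡p)
  ... | no qₘ≢p  | inj₁ i<m  rewrite kp-suc-≢ m qₘ≢p = ks≤kp m 1≤i (≤-pred i<m) qᵢ≡p

  kp≤ : ∀ {p e} m → 1 < p → zAt E m < p ^ suc e → kp E m p ≤ e
  kp≤ {p} {e} m 1<p zₘ<pᵉ⁺¹ = kp-lub m λ i 1≤i i≤m qᵢ≡p →
    ≤-pred (^-cancelʳ-< p 1<p (begin-strict
      p ^ ks E i        ≤⟨ ^≤z p (ks E i) (kpos E i 1≤i) ⟩
      z p (ks E i)      ≡⟨ cong (λ q → z q (ks E i)) (sym qᵢ≡p) ⟩
      zAt E i           ≤⟨ zAt-mono 1≤i i≤m ⟩
      zAt E m           <⟨ zₘ<pᵉ⁺¹ ⟩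
      p ^ suc e         ∎))
    where open ≤-Reasoning

  ≤kp : ∀ {p} m j → 1 ≤ m → Prime p → p ^ suc j ≤ zAt E m → j ≤ kp E m p
  ≤kp m zero    _   _  _ = z≤n
  ≤kp {p} m (suc j) 1≤m pp pʲ⁺²≤zₘ with onto E p (suc j) pp (s≤s z≤n)
  ... | i , 1≤i , qᵢ≡p , kᵢ≡j+1 = begin
    suc j       ≡⟨ sym kᵢ≡j+1 ⟩
    ks E i      ≤⟨ ks≤kp m 1≤i (zAt<⇒≤ 1≤m zᵢ<zₘ) qᵢ≡p ⟩
    kp E m p    ∎
    where
    open ≤-Reasoning
    zᵢ<zₘ : zAt E i < zAt E m
    zᵢ<zₘ = begin-strict
      zAt E i           ≡⟨ cong₂ z qᵢ≡p kᵢ≡j+1 ⟩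
      z p (suc j)       <⟨ z<^suc p (nonTrivial⇒n>1 p {{prime⇒nonTrivial pp}}) (suc j) ⟩
      p ^ suc (suc j)   ≤⟨ pʲ⁺²≤zₘ ⟩
      zAt E m           ∎

lemma2 : (E : Enumeration) (m : ℕ) → 1 ≤ m → (p : ℕ) → Prime p → p < zAt E m →
         (e : ℕ) → IsFloorLog p (zAt E m) e →
         (e ∸ 1 ≤ kp E m p) × (kp E m p ≤ e)
lemma2 E m 1≤m p pp _ e (pᵉ≤zₘ , zₘ<pᵉ⁺¹) = lower e pᵉ≤zₘ , kp≤ E m 1<p zₘ<pᵉ⁺¹
  where
  1<p : 1 < p
  1<p = nonTrivial⇒n>1 p {{prime⇒nonTrivial pp}}
  lower : ∀ e → p ^ e ≤ zAt E m → e ∸ 1 ≤ kp E m p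
  lower zero    _     = z≤n
  lower (suc j) pʲ⁺¹≤zₘ = ≤kp E m j 1≤m pp pʲ⁺¹≤zₘ
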